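{- Let $M$ be an IB-homogeneous relational structure, let $\mathfrak{A},\mathfrak{B}\in\mathrm{Age}(M)$, let $i,i'\colon\mathfrak{A}\to M$ and $e,e'\colon\mathfrak{B}\to M$ be embeddings, and let $f\colon\mathfrak{A}\to\mathfrak{B}$ be a monomorphism. Then $f\in\mathrm{Mon}^{Bi}_M(i,e)$ if and only if $f\in\mathrm{Mon}^{Bi}_M(i',e')$.
   Context: For relational structures: a monomorphism is an injective relation-preserving map; a bimorphism of $M$ is a bijective monomorphism $M\to M$; $\mathrm{Bi}(M)$ is the set of bimorphisms of $M$. $\mathrm{Age}(M)$ is the set containing one representative of each isomorphism type of finite structures embeddable into $M$. For embeddings $i\colon\mathfrak{A}\to M$, $e\colon\mathfrak{B}\to M$, $\mathrm{Mon}^{Bi}_M(i,e)$ is the set of monomorphisms $f\colon\mathfrak{A}\to\mathfrak{B}$ for which there is $F\in\mathrm{Bi}(M)$ with $F\circ i=e\circ f$. $M$ is IB-homogeneous if every isomorphism between finite induced substructures of $M$ is the restriction of a bimorphism of $M$. -}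

module Defs where

open import Level using (Level; 0ℓ; suc)
open import Data.Nat using (ℕ)
open import Data.Fin using (Fin)
open import Data.Product using (Σ; ∃; _×_; _,_)
open import Function using (_∘_; _↔_)
open import Function.Definitions using (Injective; Surjective)
open import Relation.Binary.PropositionalEquality using (_≡_)

record Signature : Set₁ where
  field
    Sym   : Set
    arity : Sym → ℕ
open Signature public

record Structure (σ : Signature) : Set₁ where
  field
    Carrier : Set
    rel     : (s : Sym σ) → (Fin (arity σ s) → Carrier) → Set
open Structure public

module _ {σ : Signature} where

  Preserves : (A B : Structure σ) → (Carrier A → Carrier B) → Set
  Preserves A B f = ∀ (s : Sym σ) (t : Fin (arity σ s) → Carrier A) →
                    rel A s t → rel B s (f ∘ t)

  Reflects : (A B : Structure σ) → (Carrier A → Carrier B) → Set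
  Reflects A B f = ∀ (s : Sym σ) (t : Fin (arity σ s) → Carrier A) →
                   rel B s (f ∘ t) → rel A s t

  IsMono : (A B : Structure σ) → (Carrier A → Carrier B) → Set
  IsMono A B f = Injective _≡_ _≡_ f × Preserves A B f

  IsEmbedding : (A B : Structure σ) → (Carrier A → Carrier B) → Set
  IsEmbedding A B f = IsMono A B f × Reflects A B f

  IsBimorphism : (M : Structure σ) → (Carrier M → Carrier M) → Set
  IsBimorphism M F = IsMono M M F × Surjective _≡_ _≡_ F

  IsFinite : Structure σ → Set
  IsFinite A = ∃ λ (n : ℕ) → Carrier A ↔ Fin n

  -- A ∈ Age(M) (up to isomorphism): A is finite and embeds into M
  InAge : (M A : Structure σ) → Set
  InAge M A = IsFinite A × ∃ λ (g : Carrier A → Carrier M) → IsEmbedding A M g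

  -- An isomorphism between finite induced substructures of M, presented by
  -- injective enumerations a, b : Fin n → M of the domain and range, the
  -- isomorphism being a k ↦ b k; it is an isomorphism iff relations agree.
  IsFinitePartialIso : (M : Structure σ) (n : ℕ) (a b : Fin n → Carrier M) → Set
  IsFinitePartialIso M n a b =
    Injective _≡_ _≡_ a × Injective _≡_ _≡_ b ×
    (∀ (s : Sym σ) (t : Fin (arity σ s) → Fin n) →
       (rel M s (a ∘ t) → rel M s (b ∘ t)) × (rel M s (b ∘ t) → rel M s (a ∘ t)))

  IBHomogeneous : Structure σ → Set
  IBHomogeneous M = ∀ (n : ℕ) (a b : Fin n → Carrier M) →
    IsFinitePartialIso M n a b →
    ∃ λ (F : Carrier M → Carrier M) → IsBimorphism M F × (∀ k → F (a k) ≡ b k)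

  InMonBi : (M A B : Structure σ) →
            (i : Carrier A → Carrier M) (e : Carrier B → Carrier M) →
            (f : Carrier A → Carrier B) → Set
  InMonBi M A B i e f =
    IsMono A B f ×
    ∃ λ (F : Carrier M → Carrier M) → IsBimorphism M F × (∀ x → F (i x) ≡ e (f x))

module Submission where

open import Defs
open import Data.Nat using (ℕ)
open import Data.Fin using (Fin)
open import Data.Product using (_×_; _,_; ∃)
open import Function using (_∘_; Inverse; Injection)
open import Function.Definitions using (Injective)
open import Function.Properties.Inverse using (↔-sym; ↔⇒↣)
import Function.Construct.Composition as Composition
open import Relation.Binary.PropositionalEquality using (_≡_; cong; subst; module ≡-Reasoning)

-- A bimorphism of M mapping one embedding of a finite structure onto another
-- exists by IB-homogeneity; pre- and post-composing with such bimorphisms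
-- moves a witness for Mon^Bi(i, e) to one for Mon^Bi(i', e').

module _ {σ : Signature} where

  Preserves-∘ : {A B C : Structure σ} {f : Carrier A → Carrier B} {g : Carrier B → Carrier C} →
                Preserves A B f → Preserves B C g → Preserves A C (g ∘ f)
  Preserves-∘ f-pres g-pres s t = g-pres s _ ∘ f-pres s t

  IsMono-∘ : {A B C : Structure σ} {f : Carrier A → Carrier B} {g : Carrier B → Carrier C} →
             IsMono A B f → IsMono B C g → IsMono A C (g ∘ f)
  IsMono-∘ {A} {B} {C} {f} {g} (f-inj , f-pres) (g-inj , g-pres) =
    Composition.injective _≡_ _≡_ _≡_ f-inj g-inj , Preserves-∘ {A} {B} {C} {f} {g} f-pres g-pres

  IsBimorphism-∘ : {M : Structure σ} {F G : Carrier M → Carrier M} →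
                   IsBimorphism M F → IsBimorphism M G → IsBimorphism M (G ∘ F)
  IsBimorphism-∘ {M} (F-mono , F-surj) (G-mono , G-surj) =
    IsMono-∘ {M} {M} {M} F-mono G-mono , Composition.surjective _≡_ _≡_ _≡_ F-surj G-surj

  embeddings⇒IsFinitePartialIso :
    {A M : Structure σ} {n : ℕ} {enum : Fin n → Carrier A} {i i' : Carrier A → Carrier M} →
    Injective _≡_ _≡_ enum → IsEmbedding A M i → IsEmbedding A M i' →
    IsFinitePartialIso M n (i ∘ enum) (i' ∘ enum)
  embeddings⇒IsFinitePartialIso enum-inj ((i-inj , i-pres) , i-refl) ((i'-inj , i'-pres) , i'-refl) =
    enum-inj ∘ i-inj , enum-inj ∘ i'-inj ,
    λ s t → i'-pres s _ ∘ i-refl s _ , i-pres s _ ∘ i'-refl s _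

  IBHomogeneous⇒embeddings-conjugate :
    {M A : Structure σ} → IBHomogeneous M → IsFinite A →
    {i i' : Carrier A → Carrier M} → IsEmbedding A M i → IsEmbedding A M i' →
    ∃ λ (H : Carrier M → Carrier M) → IsBimorphism M H × (∀ x → H (i x) ≡ i' x)
  IBHomogeneous⇒embeddings-conjugate {M} {A} ib (n , A↔Fin) {i} {i'} i-emb i'-emb =
    restrict (ib n (i ∘ from) (i' ∘ from) partialIso)
    where
    open Inverse A↔Fin using (to; from; strictlyInverseʳ)

    partialIso : IsFinitePartialIso M n (i ∘ from) (i' ∘ from)
    partialIso = embeddings⇒IsFinitePartialIso {A} {M} (Injection.injective (↔⇒↣ (↔-sym A↔Fin))) i-emb i'-emb

    restrict : ∃ (λ H → IsBimorphism M H × (∀ k → H (i (from k)) ≡ i' (from k))) →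
               ∃ (λ H → IsBimorphism M H × (∀ x → H (i x) ≡ i' x))
    restrict (H , H-bi , H-ext) =
      H , H-bi , λ x → subst (λ y → H (i y) ≡ i' y) (strictlyInverseʳ x) (H-ext (to x))

  InMonBi-conjugate :
    {M A B : Structure σ} {i i' : Carrier A → Carrier M} {e e' : Carrier B → Carrier M}
    {f : Carrier A → Carrier B} {H K : Carrier M → Carrier M} →
    IsBimorphism M H → (∀ x → H (i' x) ≡ i x) →
    IsBimorphism M K → (∀ y → K (e y) ≡ e' y) →
    InMonBi M A B i e f → InMonBi M A B i' e' f
  InMonBi-conjugate {M} {i = i} {i'} {e} {e'} {f} {H} {K} H-bi H-i K-bi K-e (f-mono , F , F-bi , F-ie) =
    f-mono , K ∘ F ∘ H , IsBimorphism-∘ {M} H-bi (IsBimorphism-∘ {M} F-bi K-bi) , commutes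
    where
    open ≡-Reasoning
    commutes : ∀ x → K (F (H (i' x))) ≡ e' (f x)
    commutes x = begin
      K (F (H (i' x)))  ≡⟨ cong (K ∘ F) (H-i x) ⟩
      K (F (i x))       ≡⟨ cong K (F-ie x) ⟩
      K (e (f x))       ≡⟨ K-e (f x) ⟩
      e' (f x)          ∎

mainTheorem3 : {σ : Signature} (M A B : Structure σ) →
    IBHomogeneous M → InAge M A → InAge M B →
    (i i' : Carrier A → Carrier M) (e e' : Carrier B → Carrier M) →
    IsEmbedding A M i → IsEmbedding A M i' →
    IsEmbedding B M e → IsEmbedding B M e' →
    (f : Carrier A → Carrier B) → IsMono A B f →
    (InMonBi M A B i e f → InMonBi M A B i' e' f) ×
    (InMonBi M A B i' e' f → InMonBi M A B i e f)
mainTheorem3 M A B ib (A-fin , _) (B-fin , _) _ _ _ _ i-emb i'-emb e-emb e'-emb f _ =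
  transfer i-emb i'-emb e-emb e'-emb , transfer i'-emb i-emb e'-emb e-emb
  where
  transfer : {i i' : Carrier A → Carrier M} {e e' : Carrier B → Carrier M} →
             IsEmbedding A M i → IsEmbedding A M i' →
             IsEmbedding B M e → IsEmbedding B M e' →
             InMonBi M A B i e f → InMonBi M A B i' e' f
  transfer i-emb i'-emb e-emb e'-emb
    with IBHomogeneous⇒embeddings-conjugate ib A-fin i'-emb i-emb
       | IBHomogeneous⇒embeddings-conjugate ib B-fin e-emb e'-emb
  ... | H , H-bi , H-i | K , K-bi , K-e = InMonBi-conjugate {M = M} {A} {B} H-bi H-i K-bi K-e
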